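{- Let $k\ge 0$ be an integer and $T$ a string. Every maximal gapped repeat $UVU=T[x\mathinner{.\,.} y)$ of period $\ell=|UV|$ in $T$ induces at most $2k+1$ (maximal) uniform $k$-runs of period $\ell$.
   Context: $T[i\mathinner{.\,.} j)=T[i]\cdots T[j-1]$, positions numbered from 1, $n=|T|$. A position $j$ is $\ell$-mismatching if $j\in[1\mathinner{.\,.} n-\ell]$ and $T[j]\ne T[j+\ell]$. A uniform $k$-run of period $\ell$ is a substring $T[a\mathinner{.\,.} b)$ with $b-a\ge 2\ell$ such that the sets $\{j\in[i\mathinner{.\,.} i+\ell): T[j]\ne T[j+\ell]\}$ for all $i\in[a\mathinner{.\,.} b-2\ell]$ have cardinality at most $k$ and are all equal; it is maximal if it cannot be extended to the left or right by a position while remaining a uniform $k$-run of period $\ell$. A gapped repeat is a fragment $T[x\mathinner{.\,.} y)=UVU$ with $|U|>0$ (arms are the two occurrences of $U$), with period $|UV|$. It is maximal (an MGR) if its arms cannot be extended simultaneously with the same character to the left or to the right, i.e., ($x=1$ or $T[x-1]\ne T[x-1+|UV|]$) and ($y=n+1$ or $T[y-|UV|]\ne T[y]$). An MGR $T[x\mathinner{.\,.} y)$ with period $\ell$ induces a uniform $k$-run $T[a\mathinner{.\,.} b)$ of period $\ell$ if $[x\mathinner{.\,.} y-\ell)\cap[a\mathinner{.\,.} b-\ell)\neq\emptyset$. -}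

module Defs where

open import Data.Nat using (ℕ; zero; suc; _+_; _*_; _∸_; _≤_; _<_; _≤?_; _<?_)
open import Data.Vec using (Vec; []; _∷_)
open import Data.Maybe using (Maybe; just; nothing)
import Data.Maybe.Properties as MP
open import Data.List using (List; length; filter; map; upTo)
open import Data.Product using (_×_; _,_; ∃-syntax)
open import Data.Sum using (_⊎_)
open import Relation.Nullary using (¬_; Dec; yes; no)
open import Relation.Nullary.Decidable using (_×-dec_; ¬?)
open import Relation.Binary.Definitions using (DecidableEquality)
open import Relation.Binary.PropositionalEquality using (_≡_; _≢_)
open import Function.Bundles using (_⇔_)

-- 1-based character access: ch T j = just T[j] for j ∈ [1..n], nothing otherwise.
ch : ∀ {A : Set} {n : ℕ} → Vec A n → ℕ → Maybe A
ch [] _ = nothing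
ch (x ∷ xs) zero = nothing
ch (x ∷ xs) (suc zero) = just x
ch (x ∷ xs) (suc (suc j)) = ch xs (suc j)

Mism : ∀ {A : Set} {n : ℕ} → Vec A n → ℕ → ℕ → Set
Mism {n = n} T ℓ j = 1 ≤ j × j + ℓ ≤ n × ch T j ≢ ch T (j + ℓ)

mism? : ∀ {A : Set} {n : ℕ} → DecidableEquality A →
        (T : Vec A n) (ℓ j : ℕ) → Dec (Mism T ℓ j)
mism? {n = n} _≟_ T ℓ j =
  (1 ≤? j) ×-dec ((j + ℓ ≤? n) ×-dec ¬? (MP.≡-dec _≟_ (ch T j) (ch T (j + ℓ))))

InS : ∀ {A : Set} {n : ℕ} → Vec A n → ℕ → ℕ → ℕ → Set
InS T ℓ i j = i ≤ j × j < i + ℓ × Mism T ℓ j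

cardS : ∀ {A : Set} {n : ℕ} → DecidableEquality A →
        Vec A n → ℕ → ℕ → ℕ
cardS _≟_ T ℓ i = length (filter (mism? _≟_ T ℓ) (map (i +_) (upTo ℓ)))

UniformRun : ∀ {A : Set} {n : ℕ} → DecidableEquality A →
             Vec A n → (k ℓ a b : ℕ) → Set
UniformRun {n = n} _≟_ T k ℓ a b =
  1 ≤ a × b ≤ suc n × 2 * ℓ ≤ b ∸ a ×
  (∀ i → a ≤ i → i ≤ b ∸ 2 * ℓ → cardS _≟_ T ℓ i ≤ k) ×
  (∀ i i' → a ≤ i → i ≤ b ∸ 2 * ℓ → a ≤ i' → i' ≤ b ∸ 2 * ℓ →
     ∀ j → (InS T ℓ i j ⇔ InS T ℓ i' j))

MaxUniformRun : ∀ {A : Set} {n : ℕ} → DecidableEquality A →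
                Vec A n → (k ℓ a b : ℕ) → Set
MaxUniformRun _≟_ T k ℓ a b =
  UniformRun _≟_ T k ℓ a b ×
  ¬ UniformRun _≟_ T k ℓ (a ∸ 1) b ×
  ¬ UniformRun _≟_ T k ℓ a (suc b)

-- T[x..y) = UVU with |U| > 0 and period ℓ = |UV|
GappedRepeat : ∀ {A : Set} {n : ℕ} → Vec A n → (x y ℓ : ℕ) → Set
GappedRepeat {n = n} T x y ℓ =
  1 ≤ x × y ≤ suc n ×
  x + ℓ < y ×                -- |U| = y - x - ℓ > 0
  y ∸ x ≤ 2 * ℓ ×            -- |V| = 2ℓ - (y - x) ≥ 0
  (∀ j → x ≤ j → j < y ∸ ℓ → ch T j ≡ ch T (j + ℓ))

MaximalGappedRepeat : ∀ {A : Set} {n : ℕ} → Vec A n → (x y ℓ : ℕ) → Set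
MaximalGappedRepeat {n = n} T x y ℓ =
  GappedRepeat T x y ℓ ×
  (x ≡ 1 ⊎ ch T (x ∸ 1) ≢ ch T (x ∸ 1 + ℓ)) ×
  (y ≡ suc n ⊎ ch T (y ∸ ℓ) ≢ ch T y)

Induces : (x y ℓ a b : ℕ) → Set
Induces x y ℓ a b = ∃[ j ] (x ≤ j × j < y ∸ ℓ × a ≤ j × j < b ∸ ℓ)

-- Write N v (countBelow v below) for the number of ℓ-mismatching positions below v.  In a
-- uniform k-run T[a..b) every mismatch of [a, b-ℓ) lies in every window [i, i+ℓ), so
-- N (b-ℓ) ≤ N a + k.  If the run is induced by the gapped repeat T[x..y), whose region [x, y-ℓ)
-- is mismatch-free, then N a ≤ N x ≤ N (b-ℓ), so the weight N a + N (b-ℓ) lies within k of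
-- 2 N x.  The weight is injective on maximal runs: these are never nested, and if a ≤ a', b < b'
-- had equal weights then N a = N a' and N (b-ℓ) = N (b'-ℓ), i.e. there is no mismatch in [a, a')
-- nor at b-ℓ, and T[a..b+1) would be a uniform run, contradicting the maximality of T[a..b).
-- Hence there are at most 2k+1 runs.
module Submission where

open import Defs
open import Data.Nat using (ℕ; zero; suc; _+_; _*_; _∸_; _≤_; _<_; _≤?_; _<?_; z<s)
open import Data.Nat.Properties
open import Data.Vec using (Vec)
open import Data.List using (List; []; _++_; _∷ʳ_; length; filter; map; upTo; applyUpTo; lookup)
open import Data.List.Properties
  using (upTo-∷ʳ; applyUpTo-∷ʳ; ++-assoc; ++-identityʳ; filter-++; length-++; filter-some; filter-none;
         map-upTo; length-map)
open import Data.List.Membership.Propositional.Properties using (∈-lookup)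
open import Data.List.Relation.Unary.All as All using (All; []; _∷_)
import Data.List.Relation.Unary.All.Properties as All
import Data.List.Relation.Unary.Any.Properties as Any
open import Data.List.Relation.Unary.AllPairs using ([]; _∷_)
open import Data.List.Relation.Unary.Unique.Propositional using (Unique)
open import Data.Fin using (Fin; zero; suc; toℕ; fromℕ<)
open import Data.Fin.Properties using (injective⇒≤; toℕ-fromℕ<)
open import Data.Product using (_×_; _,_; proj₁; proj₂; ∃-syntax)
open import Data.Sum using (inj₁; inj₂)
open import Function using (_∘_; _∘′_)
open import Function.Bundles using (Equivalence; mk⇔)
open import Relation.Nullary using (¬_; contradiction; yes; no)
open import Relation.Unary using (Decidable)
open import Relation.Binary.Definitions using (DecidableEquality)
open import Relation.Binary.PropositionalEquality

m+2*n≡m+n+n : ∀ m n → m + 2 * n ≡ m + n + n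
m+2*n≡m+n+n m n = trans (cong (λ e → m + (n + e)) (+-identityʳ n)) (sym (+-assoc m n n))

upTo-+ : ∀ m n → upTo (m + n) ≡ upTo m ++ applyUpTo (m +_) n
upTo-+ m zero = trans (cong upTo (+-identityʳ m)) (sym (++-identityʳ (upTo m)))
upTo-+ m (suc n) = begin
  upTo (m + suc n)                            ≡⟨ cong upTo (+-suc m n) ⟩
  upTo (suc (m + n))                          ≡⟨ upTo-∷ʳ (m + n) ⟨
  upTo (m + n) ∷ʳ (m + n)                     ≡⟨ cong (_∷ʳ (m + n)) (upTo-+ m n) ⟩
  (upTo m ++ applyUpTo (m +_) n) ∷ʳ (m + n)   ≡⟨ ++-assoc (upTo m) _ _ ⟩
  upTo m ++ (applyUpTo (m +_) n ∷ʳ (m + n))   ≡⟨ cong (upTo m ++_) (applyUpTo-∷ʳ (m +_) n) ⟩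
  upTo m ++ applyUpTo (m +_) (suc n)          ∎
  where open ≡-Reasoning

unique-lookup-injective : ∀ {A : Set} {xs : List A} → Unique xs →
                          ∀ i j → lookup xs i ≡ lookup xs j → i ≡ j
unique-lookup-injective (_ ∷ _) zero zero _ = refl
unique-lookup-injective (x∉xs ∷ _) zero (suc j) eq = contradiction eq (All.lookup x∉xs (∈-lookup j))
unique-lookup-injective (x∉xs ∷ _) (suc i) zero eq = contradiction (sym eq) (All.lookup x∉xs (∈-lookup i))
unique-lookup-injective (_ ∷ xs!) (suc i) (suc j) eq = cong suc (unique-lookup-injective xs! i j eq)

unique-map⁺ : ∀ {A B : Set} {P : A → Set} {f : A → B} {xs : List A} →
              (∀ {u v} → P u → P v → f u ≡ f v → u ≡ v) →
              All P xs → Unique xs → Unique (map f xs)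
unique-map⁺ f-inj [] [] = []
unique-map⁺ f-inj (pu ∷ pxs) (u∉xs ∷ xs!) =
  All.map⁺ (All.zipWith (λ (pv , u≢v) → u≢v ∘′ f-inj pu pv) (pxs , u∉xs)) ∷ unique-map⁺ f-inj pxs xs!

unique-near⇒length≤ : ∀ {c d} {ns : List ℕ} → Unique ns →
                      All (λ v → c ≤ v + d × v ≤ c + d) ns → length ns ≤ 2 * d + 1
unique-near⇒length≤ {c} {d} {ns} ns! near = injective⇒≤ {f = offset} offset-injective
  where
  offset< : ∀ {v} → v ≤ c + d → v + d ∸ c < 2 * d + 1
  offset< {v} v≤c+d = ≤-<-trans (m≤n+o⇒m∸n≤o (v + d) c (begin
      v + d       ≤⟨ +-monoˡ-≤ d v≤c+d ⟩
      c + d + d   ≡⟨ m+2*n≡m+n+n c d ⟨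
      c + 2 * d   ∎)) (m<m+n (2 * d) z<s)
    where open ≤-Reasoning
  nearᵢ : ∀ i → c ≤ lookup ns i + d × lookup ns i ≤ c + d
  nearᵢ i = All.lookup near (∈-lookup i)
  offset : Fin (length ns) → Fin (2 * d + 1)
  offset i = fromℕ< (offset< (proj₂ (nearᵢ i)))
  offset-injective : ∀ {i j} → offset i ≡ offset j → i ≡ j
  offset-injective {i} {j} eq = unique-lookup-injective ns! i j
    (+-cancelʳ-≡ d _ _ (∸-cancelʳ-≡ (proj₁ (nearᵢ i)) (proj₁ (nearᵢ j))
      (trans (sym (toℕ-fromℕ< _)) (trans (cong toℕ eq) (toℕ-fromℕ< _)))))

m∸n≡m∸2*n+n : ∀ {m} n → 2 * n ≤ m → m ∸ n ≡ m ∸ 2 * n + n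
m∸n≡m∸2*n+n {m} n 2n≤m = begin
  m ∸ n                       ≡⟨ cong (_∸ n) (m∸n+n≡m 2n≤m) ⟨
  (m ∸ 2 * n + 2 * n) ∸ n     ≡⟨ cong (_∸ n) (m+2*n≡m+n+n (m ∸ 2 * n) n) ⟩
  (m ∸ 2 * n + n + n) ∸ n     ≡⟨ m+n∸n≡m (m ∸ 2 * n + n) n ⟩
  m ∸ 2 * n + n               ∎
  where open ≡-Reasoning

+-≤-≡⇒≡ : ∀ {a b c d} → a ≤ c → b ≤ d → a + b ≡ c + d → a ≡ c × b ≡ d
+-≤-≡⇒≡ a≤c b≤d eq with m≤n⇒m<n∨m≡n a≤c
... | inj₁ a<c = contradiction eq (<⇒≢ (+-mono-<-≤ a<c b≤d))
... | inj₂ refl = refl , +-cancelˡ-≡ _ _ _ eq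

sandwich-sum : ∀ {p q x k} → p ≤ x → x ≤ q → q ≤ p + k → x + x ≤ p + q + k × p + q ≤ x + x + k
sandwich-sum {p} {q} {x} {k} p≤x x≤q q≤p+k = lower , upper
  where
  open ≤-Reasoning
  lower : x + x ≤ p + q + k
  lower = begin
    x + x        ≤⟨ +-mono-≤ x≤q x≤q ⟩
    q + q        ≤⟨ +-monoʳ-≤ q q≤p+k ⟩
    q + (p + k)  ≡⟨ +-assoc q p k ⟨
    q + p + k    ≡⟨ cong (_+ k) (+-comm q p) ⟩
    p + q + k    ∎
  upper : p + q ≤ x + x + k
  upper = begin
    p + q        ≤⟨ +-mono-≤ p≤x (≤-trans q≤p+k (+-monoˡ-≤ k p≤x)) ⟩
    x + (x + k)  ≡⟨ +-assoc x x k ⟨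
    x + x + k    ∎

module CountBelow {P : ℕ → Set} (P? : Decidable P) where

  countFrom : ℕ → ℕ → ℕ
  countFrom u l = length (filter P? (applyUpTo (u +_) l))

  countBelow : ℕ → ℕ
  countBelow v = length (filter P? (upTo v))

  countBelow-+ : ∀ u l → countBelow (u + l) ≡ countBelow u + countFrom u l
  countBelow-+ u l = begin
    length (filter P? (upTo (u + l)))                               ≡⟨ cong (length ∘ filter P?) (upTo-+ u l) ⟩
    length (filter P? (upTo u ++ applyUpTo (u +_) l))               ≡⟨ cong length (filter-++ P? (upTo u) _) ⟩
    length (filter P? (upTo u) ++ filter P? (applyUpTo (u +_) l))   ≡⟨ length-++ (filter P? (upTo u)) ⟩
    countBelow u + countFrom u l                                    ∎
    where open ≡-Reasoning

  countBelow-split : ∀ {u v} → u ≤ v → countBelow v ≡ countBelow u + countFrom u (v ∸ u)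
  countBelow-split {u} u≤v = trans (cong countBelow (sym (m+[n∸m]≡n u≤v))) (countBelow-+ u _)

  countBelow-mono-≤ : ∀ {u v} → u ≤ v → countBelow u ≤ countBelow v
  countBelow-mono-≤ {u} u≤v = subst (countBelow u ≤_) (sym (countBelow-split u≤v)) (m≤m+n _ _)

  countBelow-< : ∀ {u v m} → u ≤ m → m < v → P m → countBelow u < countBelow v
  countBelow-< {u} {v} {m} u≤m m<v pm =
    subst (countBelow u <_) (sym (countBelow-split (≤-trans u≤m (<⇒≤ m<v))))
      (m<m+n (countBelow u) (filter-some P? (Any.applyUpTo⁺ (u +_) pm′ (∸-monoˡ-< m<v u≤m))))
    where
    pm′ : P (u + (m ∸ u))
    pm′ = subst P (sym (m+[n∸m]≡n u≤m)) pm

  countBelow-≡⇒¬P : ∀ {u v m} → countBelow u ≡ countBelow v → u ≤ m → m < v → ¬ P m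
  countBelow-≡⇒¬P eq u≤m m<v pm = <-irrefl eq (countBelow-< u≤m m<v pm)

  ¬P⇒countBelow-≡ : ∀ {u v} → u ≤ v → (∀ m → u ≤ m → m < v → ¬ P m) → countBelow u ≡ countBelow v
  ¬P⇒countBelow-≡ {u} {v} u≤v none = sym (begin
    countBelow v                        ≡⟨ countBelow-split u≤v ⟩
    countBelow u + countFrom u (v ∸ u)  ≡⟨ cong (λ xs → countBelow u + length xs) no-hits ⟩
    countBelow u + 0                    ≡⟨ +-identityʳ _ ⟩
    countBelow u                        ∎)
    where
    open ≡-Reasoning
    none′ : ∀ {i} → i < v ∸ u → ¬ P (u + i)
    none′ {i} i<v∸u = none (u + i) (m≤m+n u i) (subst (u + i <_) (m+[n∸m]≡n u≤v) (+-monoʳ-< u i<v∸u))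
    no-hits : filter P? (applyUpTo (u +_) (v ∸ u)) ≡ []
    no-hits = filter-none P? (All.applyUpTo⁺₁ (u +_) (v ∸ u) none′)

  ¬P⇒countBelow-suc : ∀ {v} → ¬ P v → countBelow (suc v) ≡ countBelow v
  ¬P⇒countBelow-suc {v} ¬pv = sym (¬P⇒countBelow-≡ (n≤1+n v) λ m v≤m m<1+v →
    subst (λ j → ¬ P j) (≤-antisym v≤m (≤-pred m<1+v)) ¬pv)

module UniformRuns {A : Set} (_≟_ : DecidableEquality A) {n : ℕ} (T : Vec A n) (k ℓ : ℕ) where

  open CountBelow (mism? _≟_ T ℓ) public

  UR : ℕ → ℕ → Set
  UR = UniformRun _≟_ T k ℓ

  MaxUR : ℕ → ℕ → Set
  MaxUR = MaxUniformRun _≟_ T k ℓ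

  countBelow-+-cardS : ∀ i → countBelow (i + ℓ) ≡ countBelow i + cardS _≟_ T ℓ i
  countBelow-+-cardS i = trans (countBelow-+ i ℓ)
    (cong (λ xs → countBelow i + length (filter (mism? _≟_ T ℓ) xs)) (sym (map-upTo (i +_) ℓ)))

  mismatch⇒period>0 : ∀ {m} → Mism T ℓ m → 0 < ℓ
  mismatch⇒period>0 {m} (_ , _ , T[m]≢T[m+ℓ]) =
    n≢0⇒n>0 (λ ℓ≡0 → T[m]≢T[m+ℓ] (cong (ch T) (trans (sym (+-identityʳ m)) (cong (m +_) (sym ℓ≡0)))))

  uniformRun-length : ∀ {a b} → 0 < ℓ → UR a b → a + 2 * ℓ ≤ b
  uniformRun-length {a} {b} ℓ>0 (_ , _ , 2ℓ≤b∸a , _) =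
    subst (_≤ b) (+-comm (2 * ℓ) a) (m≤o∸n⇒m+n≤o (2 * ℓ) (<⇒≤ a<b) 2ℓ≤b∸a)
    where
    a<b : a < b
    a<b = m∸n≢0⇒n<m (λ b∸a≡0 → <⇒≱ (≤-trans ℓ>0 (m≤m+n ℓ _)) (subst (2 * ℓ ≤_) b∸a≡0 2ℓ≤b∸a))

  uniformRun-ℓ≤b : ∀ {a b} → 0 < ℓ → UR a b → ℓ ≤ b
  uniformRun-ℓ≤b {a} ℓ>0 ur = ≤-trans (m≤m+n ℓ _) (m+n≤o⇒n≤o a (uniformRun-length ℓ>0 ur))

  uniformRun-mismatch∈window : ∀ {a b m} → UR a b → Mism T ℓ m → a ≤ m → m + ℓ < b →
                               ∃[ i ] (a ≤ i × i ≤ b ∸ 2 * ℓ × InS T ℓ i m)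
  uniformRun-mismatch∈window {a} {b} {m} ur mm a≤m m+ℓ<b with m <? a + ℓ
  ... | yes m<a+ℓ =
    a , ≤-refl , m+n≤o⇒m≤o∸n a (uniformRun-length (mismatch⇒period>0 mm) ur) , a≤m , m<a+ℓ , mm
  ... | no m≮a+ℓ = suc (m ∸ ℓ) , a≤i , i≤b∸2ℓ , i≤m , m<i+ℓ , mm
    where
    ℓ≤m : ℓ ≤ m
    ℓ≤m = ≤-trans (m≤n+m ℓ a) (≮⇒≥ m≮a+ℓ)
    i+ℓ≡1+m : suc (m ∸ ℓ) + ℓ ≡ suc m
    i+ℓ≡1+m = cong suc (m∸n+n≡m ℓ≤m)
    a≤i : a ≤ suc (m ∸ ℓ)
    a≤i = m≤n⇒m≤1+n (m+n≤o⇒m≤o∸n a (≮⇒≥ m≮a+ℓ))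
    i≤m : suc (m ∸ ℓ) ≤ m
    i≤m = ∸-monoʳ-< (mismatch⇒period>0 mm) ℓ≤m
    m<i+ℓ : m < suc (m ∸ ℓ) + ℓ
    m<i+ℓ = ≤-reflexive (sym i+ℓ≡1+m)
    i≤b∸2ℓ : suc (m ∸ ℓ) ≤ b ∸ 2 * ℓ
    i≤b∸2ℓ = m+n≤o⇒m≤o∸n (suc (m ∸ ℓ))
      (subst (_≤ b) (sym (trans (m+2*n≡m+n+n (suc (m ∸ ℓ)) ℓ) (cong (_+ ℓ) i+ℓ≡1+m))) m+ℓ<b)

  -- [b-2ℓ, a+ℓ) is the intersection of the windows [i, i+ℓ) of T[a..b), a ≤ i ≤ b-2ℓ.
  MismatchesInCore : ℕ → ℕ → Set
  MismatchesInCore a b = ∀ m → Mism T ℓ m → a ≤ m → m + ℓ < b → b ≤ m + 2 * ℓ × m < a + ℓ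

  uniformRun⇒core : ∀ {a b} → UR a b → MismatchesInCore a b
  uniformRun⇒core {a} {b} ur@(_ , _ , _ , _ , same) m mm a≤m m+ℓ<b = b≤m+2ℓ , m<a+ℓ
    where
    2ℓ≤b : 2 * ℓ ≤ b
    2ℓ≤b = m+n≤o⇒n≤o a (uniformRun-length (mismatch⇒period>0 mm) ur)
    a≤c : a ≤ b ∸ 2 * ℓ
    a≤c = m+n≤o⇒m≤o∸n a (uniformRun-length (mismatch⇒period>0 mm) ur)
    in-window : ∀ {i'} → a ≤ i' → i' ≤ b ∸ 2 * ℓ → InS T ℓ i' m
    in-window a≤i' i'≤c with uniformRun-mismatch∈window ur mm a≤m m+ℓ<b
    ... | i , a≤i , i≤c , m∈Sᵢ = Equivalence.to (same i _ a≤i i≤c a≤i' i'≤c m) m∈Sᵢ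
    b≤m+2ℓ : b ≤ m + 2 * ℓ
    b≤m+2ℓ = subst (_≤ m + 2 * ℓ) (m∸n+n≡m 2ℓ≤b) (+-monoˡ-≤ (2 * ℓ) (proj₁ (in-window a≤c ≤-refl)))
    m<a+ℓ : m < a + ℓ
    m<a+ℓ = proj₁ (proj₂ (in-window ≤-refl a≤c))

  uniformRun-count : ∀ {a b} → 0 < ℓ → UR a b → countBelow (b ∸ ℓ) ≤ countBelow a + k
  uniformRun-count {a} {b} ℓ>0 ur@(_ , _ , _ , card , _) = begin
    countBelow (b ∸ ℓ)              ≡⟨ cong countBelow (m∸n≡m∸2*n+n ℓ 2ℓ≤b) ⟩
    countBelow (c + ℓ)              ≡⟨ countBelow-+-cardS c ⟩
    countBelow c + cardS _≟_ T ℓ c  ≤⟨ +-monoʳ-≤ (countBelow c) (card c a≤c ≤-refl) ⟩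
    countBelow c + k                ≡⟨ cong (_+ k) (¬P⇒countBelow-≡ a≤c no-mismatch) ⟨
    countBelow a + k                ∎
    where
    open ≤-Reasoning
    c = b ∸ 2 * ℓ
    2ℓ≤b : 2 * ℓ ≤ b
    2ℓ≤b = m+n≤o⇒n≤o a (uniformRun-length ℓ>0 ur)
    a≤c : a ≤ c
    a≤c = m+n≤o⇒m≤o∸n a (uniformRun-length ℓ>0 ur)
    no-mismatch : ∀ m → a ≤ m → m < c → ¬ Mism T ℓ m
    no-mismatch m a≤m m<c mm = <⇒≱ m+2ℓ<b (proj₁ (uniformRun⇒core ur m mm a≤m m+ℓ<b))
      where
      m+2ℓ<b : m + 2 * ℓ < b
      m+2ℓ<b = subst (m + 2 * ℓ <_) (m∸n+n≡m 2ℓ≤b) (+-monoˡ-< (2 * ℓ) m<c)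
      m+ℓ<b : m + ℓ < b
      m+ℓ<b = ≤-<-trans (+-monoʳ-≤ m (m≤m+n ℓ _)) m+2ℓ<b

  uniformRun-intro : ∀ {a b} → 1 ≤ a → b ≤ suc n → a + 2 * ℓ ≤ b → MismatchesInCore a b →
                     countBelow (b ∸ ℓ) ≤ countBelow a + k → UR a b
  uniformRun-intro {a} {b} 1≤a b≤1+n a+2ℓ≤b core count =
    1≤a , b≤1+n , m+n≤o⇒m≤o∸n (2 * ℓ) (subst (_≤ b) (+-comm a (2 * ℓ)) a+2ℓ≤b) , card ,
    λ i i' a≤i i≤c a≤i' i'≤c j → mk⇔ (transfer a≤i i≤c a≤i' i'≤c) (transfer a≤i' i'≤c a≤i i≤c)
    where
    2ℓ≤b : 2 * ℓ ≤ b
    2ℓ≤b = m+n≤o⇒n≤o a a+2ℓ≤b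
    window-end : ∀ {i} → i ≤ b ∸ 2 * ℓ → i + ℓ + ℓ ≤ b
    window-end {i} i≤c = subst (_≤ b) (m+2*n≡m+n+n i ℓ) (m≤o∸n⇒m+n≤o i 2ℓ≤b i≤c)
    card : ∀ i → a ≤ i → i ≤ b ∸ 2 * ℓ → cardS _≟_ T ℓ i ≤ k
    card i a≤i i≤c = +-cancelˡ-≤ (countBelow i) _ _ (begin
      countBelow i + cardS _≟_ T ℓ i  ≡⟨ countBelow-+-cardS i ⟨
      countBelow (i + ℓ)              ≤⟨ countBelow-mono-≤ (m+n≤o⇒m≤o∸n (i + ℓ) (window-end i≤c)) ⟩
      countBelow (b ∸ ℓ)              ≤⟨ count ⟩
      countBelow a + k                ≤⟨ +-monoˡ-≤ k (countBelow-mono-≤ a≤i) ⟩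
      countBelow i + k                ∎)
      where open ≤-Reasoning
    transfer : ∀ {i i' j} → a ≤ i → i ≤ b ∸ 2 * ℓ → a ≤ i' → i' ≤ b ∸ 2 * ℓ →
               InS T ℓ i j → InS T ℓ i' j
    transfer {i} {i'} {j} a≤i i≤c a≤i' i'≤c (i≤j , j<i+ℓ , mj) = i'≤j , j<i'+ℓ , mj
      where
      j∈core = core j mj (≤-trans a≤i i≤j) (<-≤-trans (+-monoˡ-< ℓ j<i+ℓ) (window-end i≤c))
      i'≤j : i' ≤ j
      i'≤j = +-cancelʳ-≤ (2 * ℓ) i' j (≤-trans (m≤o∸n⇒m+n≤o i' 2ℓ≤b i'≤c) (proj₁ j∈core))
      j<i'+ℓ : j < i' + ℓ
      j<i'+ℓ = <-≤-trans (proj₂ j∈core) (+-monoˡ-≤ ℓ a≤i')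

  uniformRun-shrink : ∀ {a b a' b'} → UR a b → a ≤ a' → b' ≤ b → 2 * ℓ ≤ b' ∸ a' → UR a' b'
  uniformRun-shrink {a} {b} {a'} {b'} (1≤a , b≤1+n , _ , card , same) a≤a' b'≤b 2ℓ≤b'∸a' =
    ≤-trans 1≤a a≤a' , ≤-trans b'≤b b≤1+n , 2ℓ≤b'∸a' ,
    (λ i a'≤i i≤c' → card i (≤-trans a≤a' a'≤i) (shrink-end i≤c')) ,
    (λ i i' a'≤i i≤c' a'≤i' i'≤c' →
       same i i' (≤-trans a≤a' a'≤i) (shrink-end i≤c') (≤-trans a≤a' a'≤i') (shrink-end i'≤c'))
    where
    shrink-end : ∀ {i} → i ≤ b' ∸ 2 * ℓ → i ≤ b ∸ 2 * ℓ
    shrink-end i≤c' = ≤-trans i≤c' (∸-monoˡ-≤ (2 * ℓ) b'≤b)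

  maxUniformRun-nested⇒≡ : ∀ {a b a' b'} → MaxUR a b → MaxUR a' b' → a ≤ a' → b' ≤ b →
                           (a , b) ≡ (a' , b')
  maxUniformRun-nested⇒≡ {a} {b} {a'} {b'} (ur , _) ((_ , _ , 2ℓ≤b'∸a' , _) , no-left , no-right) a≤a' b'≤b
    with m≤n⇒m<n∨m≡n a≤a' | m≤n⇒m<n∨m≡n b'≤b
  ... | inj₁ a<a' | _ = contradiction
    (uniformRun-shrink ur (m+n≤o⇒m≤o∸n a (subst (_≤ a') (+-comm 1 a) a<a')) b'≤b
      (≤-trans 2ℓ≤b'∸a' (∸-monoʳ-≤ b' (m∸n≤m a' 1)))) no-left
  ... | inj₂ refl | inj₁ b'<b = contradiction
    (uniformRun-shrink ur ≤-refl b'<b (≤-trans 2ℓ≤b'∸a' (∸-monoˡ-≤ a' (n≤1+n b')))) no-right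
  ... | inj₂ refl | inj₂ refl = refl

  uniformRun-extendʳ : ∀ {a b a' b'} → 0 < ℓ → UR a b → UR a' b' → a ≤ a' → b < b' →
                       (∀ m → a ≤ m → m < a' → ¬ Mism T ℓ m) → ¬ Mism T ℓ (b ∸ ℓ) → UR a (suc b)
  uniformRun-extendʳ {a} {b} {a'} {b'} ℓ>0 ur@(1≤a , _) ur'@(_ , b'≤1+n , _) a≤a' b<b' clean-prefix clean-end =
    uniformRun-intro 1≤a (≤-trans b<b' b'≤1+n) (m≤n⇒m≤1+n (uniformRun-length ℓ>0 ur)) core count
    where
    ℓ≤b : ℓ ≤ b
    ℓ≤b = uniformRun-ℓ≤b ℓ>0 ur
    count : countBelow (suc b ∸ ℓ) ≤ countBelow a + k
    count = begin
      countBelow (suc b ∸ ℓ)    ≡⟨ cong countBelow (+-∸-assoc 1 ℓ≤b) ⟩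
      countBelow (suc (b ∸ ℓ))  ≡⟨ ¬P⇒countBelow-suc clean-end ⟩
      countBelow (b ∸ ℓ)        ≤⟨ uniformRun-count ℓ>0 ur ⟩
      countBelow a + k          ∎
      where open ≤-Reasoning
    core : MismatchesInCore a (suc b)
    core m mm a≤m m+ℓ<1+b = ≤∧≢⇒< (proj₁ m∈core) b≢m+2ℓ , proj₂ m∈core
      where
      m+ℓ<b : m + ℓ < b
      m+ℓ<b = ≤∧≢⇒< (≤-pred m+ℓ<1+b) λ m+ℓ≡b →
        clean-end (subst (Mism T ℓ) (trans (sym (m+n∸n≡m m ℓ)) (cong (_∸ ℓ) m+ℓ≡b)) mm)
      m∈core = uniformRun⇒core ur m mm a≤m m+ℓ<b
      b≢m+2ℓ : b ≢ m + 2 * ℓ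
      b≢m+2ℓ b≡m+2ℓ with m <? a'
      ... | yes m<a' = clean-prefix m a≤m m<a' mm
      ... | no m≮a' = <⇒≱ b<b' (subst (b' ≤_) (sym b≡m+2ℓ)
                        (proj₁ (uniformRun⇒core ur' m mm (≮⇒≥ m≮a') (<-trans m+ℓ<b b<b'))))

  weight : ℕ × ℕ → ℕ
  weight (a , b) = countBelow a + countBelow (b ∸ ℓ)

  weight-injective-≤ : ∀ {a b a' b'} → 0 < ℓ → MaxUR a b → MaxUR a' b' → a ≤ a' →
                       weight (a , b) ≡ weight (a' , b') → (a , b) ≡ (a' , b')
  weight-injective-≤ {a} {b} {a'} {b'} ℓ>0 max@(ur , _ , no-right) max'@(ur' , _) a≤a' eq with b' ≤? b
  ... | yes b'≤b = maxUniformRun-nested⇒≡ max max' a≤a' b'≤b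
  ... | no b'≰b = contradiction
    (uniformRun-extendʳ ℓ>0 ur ur' a≤a' b<b' (λ m a≤m m<a' → countBelow-≡⇒¬P same-start a≤m m<a')
                         (countBelow-≡⇒¬P same-end ≤-refl b∸ℓ<b'∸ℓ))
    no-right
    where
    b<b' : b < b'
    b<b' = ≰⇒> b'≰b
    ℓ≤b : ℓ ≤ b
    ℓ≤b = uniformRun-ℓ≤b ℓ>0 ur
    b∸ℓ<b'∸ℓ : b ∸ ℓ < b' ∸ ℓ
    b∸ℓ<b'∸ℓ = ∸-monoˡ-< b<b' ℓ≤b
    same = +-≤-≡⇒≡ (countBelow-mono-≤ a≤a') (countBelow-mono-≤ (<⇒≤ b∸ℓ<b'∸ℓ)) eq
    same-start : countBelow a ≡ countBelow a'
    same-start = proj₁ same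
    same-end : countBelow (b ∸ ℓ) ≡ countBelow (b' ∸ ℓ)
    same-end = proj₂ same

  weight-injective : ∀ {a b a' b'} → 0 < ℓ → MaxUR a b → MaxUR a' b' →
                     weight (a , b) ≡ weight (a' , b') → (a , b) ≡ (a' , b')
  weight-injective {a} {a' = a'} ℓ>0 max max' eq with ≤-total a a'
  ... | inj₁ a≤a' = weight-injective-≤ ℓ>0 max max' a≤a' eq
  ... | inj₂ a'≤a = sym (weight-injective-≤ ℓ>0 max' max a'≤a (sym eq))

  gappedRepeat-period>0 : ∀ {x y} → GappedRepeat T x y ℓ → 0 < ℓ
  gappedRepeat-period>0 {x} {y} (_ , _ , x+ℓ<y , y∸x≤2ℓ , _) =
    *-cancelˡ-< 2 0 ℓ (<-≤-trans (m<n⇒0<n∸m (≤-<-trans (m≤m+n x ℓ) x+ℓ<y)) y∸x≤2ℓ)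

  gappedRepeat-no-mismatch : ∀ {x y m} → GappedRepeat T x y ℓ → x ≤ m → m < y ∸ ℓ → ¬ Mism T ℓ m
  gappedRepeat-no-mismatch (_ , _ , _ , _ , repeat) x≤m m<y∸ℓ (_ , _ , T[m]≢T[m+ℓ]) =
    T[m]≢T[m+ℓ] (repeat _ x≤m m<y∸ℓ)

  weight-near : ∀ {x y a b} → GappedRepeat T x y ℓ → UR a b → Induces x y ℓ a b →
                let c = countBelow x + countBelow x in
                c ≤ weight (a , b) + k × weight (a , b) ≤ c + k
  weight-near {x} {y} {a} {b} gr ur (j , x≤j , j<y∸ℓ , a≤j , j<b∸ℓ) =
    sandwich-sum start≤x x≤end (uniformRun-count (gappedRepeat-period>0 gr) ur)
    where
    start≤x : countBelow a ≤ countBelow x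
    start≤x = ≤-trans (countBelow-mono-≤ (<⇒≤ (≤-<-trans a≤j j<y∸ℓ)))
                (≤-reflexive (sym (¬P⇒countBelow-≡ (<⇒≤ (≤-<-trans x≤j j<y∸ℓ))
                  (λ m x≤m m<y∸ℓ → gappedRepeat-no-mismatch gr x≤m m<y∸ℓ))))
    x≤end : countBelow x ≤ countBelow (b ∸ ℓ)
    x≤end = countBelow-mono-≤ (<⇒≤ (≤-<-trans x≤j j<b∸ℓ))

lemma8 : {A : Set} (_≟_ : DecidableEquality A) (n : ℕ) (T : Vec A n) (k x y ℓ : ℕ) →
    MaximalGappedRepeat T x y ℓ →
    (runs : List (ℕ × ℕ)) → Unique runs →
    All (λ { (a , b) → MaxUniformRun _≟_ T k ℓ a b × Induces x y ℓ a b }) runs →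
    length runs ≤ 2 * k + 1
lemma8 _≟_ n T k x y ℓ (repeat , _) runs runs! good = begin
  length runs               ≡⟨ length-map weight runs ⟨
  length (map weight runs)  ≤⟨ unique-near⇒length≤ weights! weights-near ⟩
  2 * k + 1                 ∎
  where
  open ≤-Reasoning
  open UniformRuns _≟_ T k ℓ
  weights! : Unique (map weight runs)
  weights! = unique-map⁺
    (λ { {_ , _} {_ , _} (max , _) (max′ , _) → weight-injective (gappedRepeat-period>0 repeat) max max′ })
    good runs!
  weights-near : All (λ v → countBelow x + countBelow x ≤ v + k × v ≤ countBelow x + countBelow x + k)
                     (map weight runs)
  weights-near = All.map⁺ (All.map (λ { {_ , _} (max , induced) → weight-near repeat (proj₁ max) induced }) good)
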